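{- Let $X$ be a finite temporal transit and $S\subseteq X$. Then $S$ is archival if and only if for all $x,z\in X$: if $zR^{\triangleleft}x$ and $x\notin S$ and $z\in S$, then ${\downarrow}z\cap{\uparrow}x\cap\mathrm{Refl}(X)\cap S\neq\emptyset$.
   Context: A temporal transit is a structure $(X,R^{\triangleleft},R^{\triangleright},\le)$ where $\le$ is a partial order on $X$ equal to the reflexive closure $R^{\triangleright}\cup\Delta_X$ of $R^{\triangleright}$, and $R^{\triangleleft}$ is the converse of $R^{\triangleright}$. $\mathrm{Refl}(X)=\{v: vR^{\triangleright}v\}$. A subset $S$ is archival if for all $x,z$: if $x\notin S$, $z\in S$ and $zR^{\triangleleft}x$, then $R^{\triangleleft}[z]\cap{\uparrow}x\cap S\neq\emptyset$, where $R^{\triangleleft}[z]=\{y:zR^{\triangleleft}y\}$. -}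

module Defs where

open import Level using (Level; _⊔_; suc)
open import Data.Nat using (ℕ)
open import Data.Fin using (Fin)
open import Data.Fin.Subset using (Subset; _∈_; _∉_)
open import Data.Product using (Σ; ∃; _×_; _,_)
open import Data.Sum using (_⊎_)
open import Relation.Nullary using (¬_)
open import Relation.Binary.PropositionalEquality using (_≡_)

ReflClosure : {X : Set} → (X → X → Set) → X → X → Set
ReflClosure R x y = R x y ⊎ x ≡ y

-- A finite temporal transit on the carrier Fin n.
-- The only data is R▷; R◁ is its converse and ≤ is its reflexive closure,
-- which is required to be a partial order (reflexivity is automatic).
record TemporalTransit (n : ℕ) : Set₁ where
  field
    R▷ : Fin n → Fin n → Set
  X : Set
  X = Fin n
  R◁ : X → X → Set
  R◁ x y = R▷ y x
  _≤_ : X → X → Set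
  _≤_ = ReflClosure R▷
  field
    ≤-trans   : ∀ {x y z} → x ≤ y → y ≤ z → x ≤ z
    ≤-antisym : ∀ {x y} → x ≤ y → y ≤ x → x ≡ y

  ↑ : X → X → Set
  ↑ x y = x ≤ y
  ↓ : X → X → Set
  ↓ z y = y ≤ z

  R◁[_] : X → X → Set
  R◁[ z ] y = R◁ z y

  Refl : X → Set
  Refl v = R▷ v v

  Archival : Subset n → Set
  Archival S = ∀ x z → x ∉ S → z ∈ S → R◁ z x →
               ∃ λ y → R◁[ z ] y × ↑ x y × y ∈ S

-- Forward direction: for fixed x ∉ S and z ∈ S with z R◁ x, the points y ∈ S with
-- x R▷ y ≤ z are closed under taking the R▷-predecessor provided by archivality
-- (it lies in S, so it differs from x).  Iterating gives an R▷-descending sequence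
-- in a finite transitive frame, which must repeat a point; that point is reflexive.
module Submission where

open import Defs
open import Data.Nat as ℕ using (ℕ; zero; suc; s≤s)
open import Data.Nat.Properties using (m≤n⇒m<n∨m≡n; n<1+n)
open import Data.Fin using (Fin; toℕ)
open import Data.Fin.Properties using (pigeonhole)
open import Data.Fin.Subset using (Subset; _∈_; _∉_)
open import Data.Product using (Σ; ∃; _×_; _,_; proj₁; proj₂)
open import Data.Sum using (inj₁; inj₂)
open import Data.Empty using (⊥-elim)
open import Level using (Level)
open import Relation.Binary.Core using (Rel)
open import Relation.Binary.Definitions using (Transitive)
open import Relation.Binary.PropositionalEquality using (refl; subst; sym)
open import Function.Bundles using (_⇔_; mk⇔)

module _ {n : ℕ} {ℓ p : Level} {_≺_ : Rel (Fin n) ℓ} (≺-trans : Transitive _≺_)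
         (P : Fin n → Set p)
         (≺-closed : ∀ {y} → P y → ∃ λ y′ → P y′ × y′ ≺ y) where

  private
    predecessor : Σ (Fin n) P → Σ (Fin n) P
    predecessor (y , py) = let (y′ , py′ , _) = ≺-closed py in y′ , py′

    predecessor-≺ : ∀ s → proj₁ (predecessor s) ≺ proj₁ s
    predecessor-≺ (y , py) = proj₂ (proj₂ (≺-closed py))

    chain : Σ (Fin n) P → ℕ → Σ (Fin n) P
    chain s zero    = s
    chain s (suc k) = predecessor (chain s k)

    chain-descending : ∀ s {i j} → i ℕ.< j → proj₁ (chain s j) ≺ proj₁ (chain s i)
    chain-descending s {i} {suc j} (s≤s i≤j) with m≤n⇒m<n∨m≡n i≤j
    ... | inj₁ i<j  = ≺-trans (predecessor-≺ (chain s j)) (chain-descending s i<j)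
    ... | inj₂ refl = predecessor-≺ (chain s j)

  finite-descent⇒reflexive : ∀ {y} → P y → ∃ λ r → P r × r ≺ r
  finite-descent⇒reflexive {y} py
    with i , j , i<j , cᵢ≡cⱼ ← pigeonhole (n<1+n n) (λ k → proj₁ (chain (y , py) (toℕ k)))
    = proj₁ cᵢ , proj₂ cᵢ , subst (_≺ proj₁ cᵢ) (sym cᵢ≡cⱼ) (chain-descending (y , py) i<j)
    where cᵢ = chain (y , py) (toℕ i)

module _ {n : ℕ} (T : TemporalTransit n) where
  open TemporalTransit T

  R▷-trans : Transitive R▷
  R▷-trans {a} ab bc with ≤-trans (inj₁ ab) (inj₁ bc)
  ... | inj₁ ac   = ac
  ... | inj₂ refl = subst (R▷ a) (sym (≤-antisym (inj₁ ab) (inj₁ bc))) ab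

  R▷-≤-trans : ∀ {x y z} → R▷ x y → y ≤ z → R▷ x z
  R▷-≤-trans xy (inj₁ yz) = R▷-trans xy yz
  R▷-≤-trans xy (inj₂ refl) = xy

  module _ (S : Subset n) where

    ReflexiveWitness : Fin n → Fin n → Set
    ReflexiveWitness x z = ∃ λ y → ↓ z y × ↑ x y × Refl y × y ∈ S

    reflexiveWitness⇒archival : (∀ x z → R◁ z x → x ∉ S → z ∈ S → ReflexiveWitness x z) →
                                Archival S
    reflexiveWitness⇒archival w x z x∉S z∈S zR◁x with w x z zR◁x x∉S z∈S
    ... | y , inj₁ yR▷z , x≤y , _ , y∈S = y , yR▷z , x≤y , y∈S
    ... | y , inj₂ refl , x≤y , yR▷y , y∈S = y , yR▷y , x≤y , y∈S

    module _ (archival : Archival S) (x z : Fin n) (x∉S : x ∉ S) where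

      Between : Fin n → Set
      Between y = y ∈ S × R▷ x y × y ≤ z

      Between-predecessor : ∀ {y} → Between y → ∃ λ y′ → Between y′ × R▷ y′ y
      Between-predecessor {y} (y∈S , xR▷y , y≤z) with archival x y x∉S y∈S xR▷y
      ... | y′ , y′R▷y , inj₁ xR▷y′ , y′∈S = y′ , (y′∈S , xR▷y′ , inj₁ (R▷-≤-trans y′R▷y y≤z)) , y′R▷y
      ... | _  , _     , inj₂ refl  , x∈S  = ⊥-elim (x∉S x∈S)

    archival⇒reflexiveWitness : Archival S →
                                ∀ x z → R◁ z x → x ∉ S → z ∈ S → ReflexiveWitness x z
    archival⇒reflexiveWitness archival x z zR◁x x∉S z∈S
      with r , (r∈S , xR▷r , r≤z) , rR▷r ←
             finite-descent⇒reflexive R▷-trans (Between archival x z x∉S)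
               (Between-predecessor archival x z x∉S) (z∈S , zR◁x , inj₂ refl)
      = r , r≤z , inj₁ xR▷r , rR▷r , r∈S

proposition4p5 : (n : ℕ) (T : TemporalTransit n) (S : Subset n) →
    let open TemporalTransit T in
    Archival S ⇔
      (∀ x z → R◁ z x → x ∉ S → z ∈ S →
        ∃ λ y → ↓ z y × ↑ x y × Refl y × y ∈ S)
proposition4p5 n T S = mk⇔ (archival⇒reflexiveWitness T S) (reflexiveWitness⇒archival T S)
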